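{- Let $w=i_n\cdots i_1$ be a reverse lattice word and let $\sigma=\mathrm{std}(w)$. Then $T_w=P(\sigma^{ -1})$, the insertion tableau of $\sigma^{ -1}$ under the variant Robinson–Schensted algorithm.
   Context: A word $w=i_n\cdots i_1$ of positive integers (first letter $i_n$) is reverse lattice if in every suffix the number of letters $j$ is at least the number of letters $j+1$, for all $j\ge1$. Young diagrams in French convention (rows bottom to top, columns left to right). With $\lambda_0=\varnothing$ and $\lambda_k$ obtained from $\lambda_{k-1}$ by adding a box at the addable node in column $i_k$, $T_w$ is the standard reverse tableau of shape $\lambda_n$ with entry $n-k+1$ in the box $\lambda_k\setminus\lambda_{k-1}$. The standardization of $w=w_1\cdots w_n$ is the permutation $\sigma$ with $\sigma(p)<\sigma(q)$ iff $w_p<w_q$, or $w_p=w_q$ and $p<q$. Variant Robinson–Schensted algorithm on $\pi\in\mathfrak{S}_n$: start with empty $P_0,Q_0$; for $i=1,\dots,n$, set $y=\pi(i)$ and $r$ = bottom row; while $y$ exceeds some entry of row $r$, let $x$ be the greatest entry of row $r$ smaller than $y$, replace $x$ by $y$, set $y:=x$ and move to the next row up; then place $y$ at the right end of row $r$, giving $P_i$; if $y$ landed in box $(a,b)$, $Q_i$ is $Q_{i-1}$ with $n-i+1$ placed in $(a,b)$. $P(\pi)=P_n$, $Q(\pi)=Q_n$. -}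

module Defs where

open import Data.Nat using (ℕ; zero; suc; _+_; _≤_; _<ᵇ_; _≡ᵇ_; _≤ᵇ_; _⊔_)
open import Data.Bool using (Bool; true; false; if_then_else_)
open import Data.List using (List; []; _∷_; _++_; [_]; length; drop; map; applyUpTo; foldl)
open import Data.Maybe using (Maybe; just; nothing)

-- A word w = i_n ⋯ i_1 is represented as the list [w_1, …, w_n] (first letter
-- first), so i_k = w_{n-k+1}.

countBy : (ℕ → Bool) → List ℕ → ℕ
countBy p [] = 0
countBy p (x ∷ xs) = if p x then suc (countBy p xs) else countBy p xs

occ : ℕ → List ℕ → ℕ
occ j xs = countBy (λ x → x ≡ᵇ j) xs

Positive : List ℕ → Set
Positive [] = Data.Unit.⊤ where import Data.Unit
Positive (x ∷ xs) = (1 ≤ x) Data.Product.× Positive xs where import Data.Product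

IsReverseLattice : List ℕ → Set
IsReverseLattice w = ∀ (k j : ℕ) → 1 ≤ j → occ (suc j) (drop k w) ≤ occ j (drop k w)

-- Tableaux (French convention): list of rows from bottom to top,
-- each row the list of its entries from left to right.
Tableau : Set
Tableau = List (List ℕ)

-- add a box with entry x at the addable node in column c (columns 1-indexed):
-- skip the rows that already have a box in column c, and append to the first
-- row that does not (a new row if none).
addCol : ℕ → ℕ → Tableau → Tableau
addCol c x [] = [ [ x ] ]
addCol c x (row ∷ rows) = if c ≤ᵇ length row then row ∷ addCol c x rows
                                                  else (row ++ [ x ]) ∷ rows

-- T_w: process i_1 (= w_n) first; the box created by the letter w_p
-- (i.e. i_k with k = n-p+1) receives entry p = n-k+1.
buildT : ℕ → List ℕ → Tableau
buildT p [] = []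
buildT p (c ∷ ws) = addCol c p (buildT (suc p) ws)

T : List ℕ → Tableau
T w = buildT 1 w

-- standardization, one-line notation [σ(1), …, σ(n)]:
-- σ(p) = #{q : w_q < w_p} + #{q < p : w_q = w_p} + 1
stdGo : List ℕ → List ℕ → List ℕ → List ℕ
stdGo w pre [] = []
stdGo w pre (x ∷ xs) =
  suc (countBy (λ y → y <ᵇ x) w + countBy (λ y → y ≡ᵇ x) pre) ∷ stdGo w (x ∷ pre) xs

std : List ℕ → List ℕ
std w = stdGo w [] w

pos : ℕ → List ℕ → ℕ
pos v [] = 0
pos v (z ∷ zs) = if z ≡ᵇ v then 1 else suc (pos v zs)

inverse : List ℕ → List ℕ
inverse π = applyUpTo (λ i → pos (suc i) π) (length π)

greatestBelow : ℕ → List ℕ → Maybe ℕ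
greatestBelow y [] = nothing
greatestBelow y (z ∷ zs) with greatestBelow y zs | z <ᵇ y
... | m       | false = m
... | nothing | true  = just z
... | just m  | true  = just (m ⊔ z)

replace : ℕ → ℕ → List ℕ → List ℕ
replace x y [] = []
replace x y (z ∷ zs) = if z ≡ᵇ x then y ∷ zs else z ∷ replace x y zs

insert : ℕ → Tableau → Tableau
insert y [] = [ [ y ] ]
insert y (row ∷ rows) with greatestBelow y row
... | nothing = (row ++ [ y ]) ∷ rows
... | just x  = replace x y row ∷ insert x rows

P : List ℕ → Tableau
P π = foldl (λ t y → insert y t) [] π

-- Pair each letter of w with its value under σ = std w and, for k ≤ n, mask the letters whose
-- value exceeds k.  Building the tableau of the masked word as T_w is built (masked letters add no
-- box) gives ∅ for k = 0 and T_w for k = n; it is P of the first k letters of σ⁻¹.  Indeed,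
-- revealing the letter m at position p = σ⁻¹(k+1) adds the box with entry p in column m.  Column
-- lengths count letters, and all later letters m are still masked, so column m of the tableau of
-- the later letters is empty: the box goes to the end of the bottom row, which is exactly where
-- row insertion puts the entry p, smaller than all entries there.  Boxes of earlier letters carry
-- entries smaller than p, and adding such a box at an addable node commutes with inserting p.
-- Masking preserves the reverse lattice property, because σ numbers all letters j before all
-- letters j+1.

module Submission where

open import Defs
open import Data.Nat using (ℕ; zero; suc; _+_; _≤_; _<_; _<ᵇ_; _≡ᵇ_; _≤ᵇ_; _⊔_; z≤n; s≤s; pred)
open import Data.Nat.Properties
open import Algebra.Properties.CommutativeSemigroup +-commutativeSemigroup using (interchange)
open import Data.Bool using (Bool; true; false; if_then_else_)
open import Data.List using (List; []; _∷_; length; drop; map; applyUpTo; _∷ʳ_)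
open import Data.List.Properties using (length-++; length-map; drop-map; applyUpTo-∷ʳ; foldl-∷ʳ)
open import Data.List.Relation.Unary.All as All using (All; []; _∷_)
open import Data.List.Relation.Unary.All.Properties using (++⁺; map⁺; map⁻; drop⁺; ¬Any⇒All¬)
open import Data.List.Relation.Unary.Any using (Any; here; there; any?)
open import Data.List.Relation.Unary.AllPairs as AllPairs using (AllPairs; []; _∷_)
import Data.List.Relation.Unary.AllPairs.Properties as AllPairs
open import Data.List.Membership.Propositional using (_∈_; find)
open import Data.Maybe using (Maybe; just; nothing; fromMaybe)
import Data.Maybe.Relation.Unary.All as Maybe
open import Data.Product using (Σ; ∃-syntax; _×_; _,_; proj₁; proj₂)
open import Data.Sum using (_⊎_; inj₁; inj₂)
open import Data.Empty using (⊥-elim)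
open import Data.Unit using (⊤; tt)
open import Function using (_∘_)
open import Relation.Nullary using (yes; no)
open import Relation.Nullary.Decidable using (dec-true; dec-false; _×-dec_)
open import Relation.Binary.Definitions using (tri<; tri≈; tri>)
open import Relation.Binary.PropositionalEquality hiding ([_])

≤ᵇ-true : ∀ {m n} → m ≤ n → (m ≤ᵇ n) ≡ true
≤ᵇ-true = dec-true (_ ≤? _)

≤ᵇ-false : ∀ {m n} → n < m → (m ≤ᵇ n) ≡ false
≤ᵇ-false n<m = dec-false (_ ≤? _) (<⇒≱ n<m)

<ᵇ-true : ∀ {m n} → m < n → (m <ᵇ n) ≡ true
<ᵇ-true = dec-true (_ <? _)

<ᵇ-false : ∀ {m n} → n ≤ m → (m <ᵇ n) ≡ false
<ᵇ-false n≤m = dec-false (_ <? _) (≤⇒≯ n≤m)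

≡ᵇ-true : ∀ {m n} → m ≡ n → (m ≡ᵇ n) ≡ true
≡ᵇ-true = dec-true (_ ≟ _)

≡ᵇ-false : ∀ {m n} → m ≢ n → (m ≡ᵇ n) ≡ false
≡ᵇ-false = dec-false (_ ≟ _)

length-∷ʳ : ∀ (r : List ℕ) y → length (r ∷ʳ y) ≡ suc (length r)
length-∷ʳ r y = trans (length-++ r) (+-comm (length r) 1)

greatestBelow-All : ∀ {P : ℕ → Set} y {r} → All P r → Maybe.All P (greatestBelow y r)
greatestBelow-All y [] = Maybe.nothing
greatestBelow-All y {z ∷ zs} (pz ∷ ps) with greatestBelow y zs | greatestBelow-All y ps | z <ᵇ y
... | m       | pm            | false = pm
... | nothing | _             | true  = Maybe.just pz
... | just m  | Maybe.just pm | true with ⊔-sel m z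
...   | inj₁ m⊔z≡m rewrite m⊔z≡m = Maybe.just pm
...   | inj₂ m⊔z≡z rewrite m⊔z≡z = Maybe.just pz

greatestBelow-≤ : ∀ y {r} → All (y ≤_) r → greatestBelow y r ≡ nothing
greatestBelow-≤ y [] = refl
greatestBelow-≤ y {z ∷ zs} (y≤z ∷ ps) rewrite greatestBelow-≤ y ps | <ᵇ-false y≤z = refl

greatestBelow-∷ʳ : ∀ y s r → s < y → All (s <_) r →
                   greatestBelow y (r ∷ʳ s) ≡ just (fromMaybe s (greatestBelow y r))
greatestBelow-∷ʳ y s [] s<y [] rewrite <ᵇ-true s<y = refl
greatestBelow-∷ʳ y s (z ∷ zs) s<y (s<z ∷ ps) rewrite greatestBelow-∷ʳ y s zs s<y ps
  with greatestBelow y zs | z <ᵇ y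
... | nothing | false = refl
... | nothing | true  = cong just (m≤n⇒m⊔n≡n (<⇒≤ s<z))
... | just m  | false = refl
... | just m  | true  = refl

replace-∷ʳ : ∀ x y s r → x ≢ s → replace x y (r ∷ʳ s) ≡ replace x y r ∷ʳ s
replace-∷ʳ x y s [] x≢s rewrite ≡ᵇ-false (x≢s ∘ sym) = refl
replace-∷ʳ x y s (z ∷ zs) x≢s with z ≡ᵇ x
... | true  = refl
... | false = cong (z ∷_) (replace-∷ʳ x y s zs x≢s)

replace-last : ∀ y s r → All (s <_) r → replace s y (r ∷ʳ s) ≡ r ∷ʳ y
replace-last y s [] [] rewrite ≡ᵇ-true {s} refl = refl
replace-last y s (z ∷ zs) (s<z ∷ ps) rewrite ≡ᵇ-false (>⇒≢ s<z) = cong (z ∷_) (replace-last y s zs ps)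

length-replace : ∀ x y r → length (replace x y r) ≡ length r
length-replace x y [] = refl
length-replace x y (z ∷ zs) with z ≡ᵇ x
... | true  = refl
... | false = cong suc (length-replace x y zs)

-- Adding a box versus row insertion

headLength : Tableau → ℕ
headLength []      = 0
headLength (r ∷ _) = length r

data Addable : ℕ → Tableau → Set where
  new-row : Addable 1 []
  above   : ∀ {c r rs} → c ≤ length r → Addable c rs → Addable c (r ∷ rs)
  row-end : ∀ {r rs} → headLength rs ≤ length r → Addable (suc (length r)) (r ∷ rs)

_<ᵀ_ : ℕ → Tableau → Set
s <ᵀ t = All (All (s <_)) t

addCol≡insert-beyondBottom : ∀ c s t → headLength t < c → s <ᵀ t → addCol c s t ≡ insert s t
addCol≡insert-beyondBottom c s []       _   _         = refl
addCol≡insert-beyondBottom c s (r ∷ rs) r<c (s<r ∷ _)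
  rewrite ≤ᵇ-false r<c | greatestBelow-≤ s (All.map <⇒≤ s<r) = refl

addCol-insert-comm : ∀ {c} s y t → Addable c t → s <ᵀ t → s < y →
                     addCol c s (insert y t) ≡ insert y (addCol c s t)
addCol-insert-comm s y [] new-row [] s<y rewrite <ᵇ-true s<y | ≡ᵇ-true {s} refl = refl
addCol-insert-comm {c} s y (r ∷ rs) (above c≤r addable) (s<r ∷ s<rs) s<y rewrite ≤ᵇ-true c≤r
  with greatestBelow y r | greatestBelow-All y s<r
... | nothing | _ rewrite ≤ᵇ-true (≤-trans c≤r (subst (length r ≤_) (sym (length-∷ʳ r y)) (n≤1+n _))) = refl
... | just x  | Maybe.just s<x rewrite length-replace x y r | ≤ᵇ-true c≤r =
  cong (replace x y r ∷_) (addCol-insert-comm s x rs addable s<rs s<x)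
addCol-insert-comm s y (r ∷ rs) (row-end rs≤r) (s<r ∷ s<rs) s<y
  rewrite ≤ᵇ-false (n<1+n (length r)) | greatestBelow-∷ʳ y s r s<y s<r
  with greatestBelow y r | greatestBelow-All y s<r
... | nothing | _ rewrite length-∷ʳ r y | ≤ᵇ-true (≤-refl {suc (length r)}) | replace-last y s r s<r =
  cong (r ∷ʳ y ∷_) (addCol≡insert-beyondBottom _ s rs (s≤s rs≤r) s<rs)
... | just x  | Maybe.just s<x
  rewrite length-replace x y r | ≤ᵇ-false (n<1+n (length r)) | replace-∷ʳ x y s r (>⇒≢ s<x) = refl

addCol-All : ∀ {P : ℕ → Set} c x t → P x → All (All P) t → All (All P) (addCol c x t)
addCol-All c x []       px []         = (px ∷ []) ∷ []
addCol-All c x (r ∷ rs) px (pr ∷ prs) with c ≤ᵇ length r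
... | true  = pr ∷ addCol-All c x rs px prs
... | false = ++⁺ pr (px ∷ []) ∷ prs

colLength : ℕ → Tableau → ℕ
colLength d []       = 0
colLength d (r ∷ rs) = if d ≤ᵇ length r then suc (colLength d rs) else colLength d rs

Partition≤ : ℕ → Tableau → Set
Partition≤ b []       = ⊤
Partition≤ b (r ∷ rs) = 1 ≤ length r × length r ≤ b × Partition≤ (length r) rs

Partition≤-weaken : ∀ {b b′} t → b ≤ b′ → Partition≤ b t → Partition≤ b′ t
Partition≤-weaken []       _    _               = tt
Partition≤-weaken (r ∷ rs) b≤b′ (r≥1 , r≤b , p) = r≥1 , ≤-trans r≤b b≤b′ , p

headLength≤ : ∀ {b} t → Partition≤ b t → headLength t ≤ b
headLength≤ []       _           = z≤n
headLength≤ (r ∷ rs) (_ , r≤b , _) = r≤b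

colLength-beyond : ∀ {b} d t → Partition≤ b t → b < d → colLength d t ≡ 0
colLength-beyond d []       _               _   = refl
colLength-beyond d (r ∷ rs) (_ , r≤b , p) b<d rewrite ≤ᵇ-false (≤-<-trans r≤b b<d) =
  colLength-beyond d rs p (≤-<-trans r≤b b<d)

addable-1 : ∀ {b} t → Partition≤ b t → Addable 1 t
addable-1 []       _           = new-row
addable-1 (r ∷ rs) (r≥1 , _ , p) = above r≥1 (addable-1 rs p)

addable-colLength< : ∀ {b} c t → Partition≤ b t →
                     colLength (2 + c) t < colLength (1 + c) t → Addable (2 + c) t
addable-colLength< c (r ∷ rs) (_ , _ , p) col< with 2 + c ≤? length r | 1 + c ≤? length r
... | yes 2+c≤r | _ rewrite ≤ᵇ-true 2+c≤r | ≤ᵇ-true (≤-trans (n≤1+n _) 2+c≤r) =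
  above 2+c≤r (addable-colLength< c rs p (≤-pred col<))
... | no 2+c≰r | yes 1+c≤r =
  subst (λ d → Addable d (r ∷ rs)) r≡1+c (row-end (headLength≤ rs p))
  where
  r≡1+c : suc (length r) ≡ 2 + c
  r≡1+c = cong suc (≤-antisym (≤-pred (≰⇒> 2+c≰r)) 1+c≤r)
... | no 2+c≰r | no 1+c≰r
  rewrite ≤ᵇ-false (≰⇒> 2+c≰r) | ≤ᵇ-false (≰⇒> 1+c≰r) | colLength-beyond (1 + c) rs p (≰⇒> 1+c≰r) =
  ⊥-elim (n≮0 col<)

addCol-Partition≤ : ∀ {c b} s t → Addable c t → Partition≤ b t → c ≤ b → Partition≤ b (addCol c s t)
addCol-Partition≤ s [] new-row _ 1≤b = ≤-refl , 1≤b , tt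
addCol-Partition≤ s (r ∷ rs) (above c≤r addable) (r≥1 , r≤b , p) _ rewrite ≤ᵇ-true c≤r =
  r≥1 , r≤b , addCol-Partition≤ s rs addable p c≤r
addCol-Partition≤ s (r ∷ rs) (row-end _) (_ , _ , p) 1+r≤b
  rewrite ≤ᵇ-false (n<1+n (length r)) | length-∷ʳ r s =
  s≤s z≤n , 1+r≤b , Partition≤-weaken rs (n≤1+n _) p

colLength-addCol : ∀ {c} d s t → Addable c t → 1 ≤ d →
                   colLength d (addCol c s t) ≡ (if c ≡ᵇ d then suc (colLength d t) else colLength d t)
colLength-addCol (suc zero)    s [] new-row _ = refl
colLength-addCol (suc (suc _)) s [] new-row _ = refl
colLength-addCol {c} d s (r ∷ rs) (above c≤r addable) d≥1
  rewrite ≤ᵇ-true c≤r | colLength-addCol d s rs addable d≥1 with c ≡ᵇ d | d ≤ᵇ length r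
... | true  | true  = refl
... | true  | false = refl
... | false | true  = refl
... | false | false = refl
colLength-addCol d s (r ∷ rs) (row-end _) _
  rewrite ≤ᵇ-false (n<1+n (length r)) | length-∷ʳ r s with <-cmp d (suc (length r))
... | tri< d<1+r _ _
  rewrite ≤ᵇ-true (<⇒≤ d<1+r) | ≤ᵇ-true (≤-pred d<1+r) | ≡ᵇ-false (>⇒≢ d<1+r) = refl
... | tri≈ _ refl _
  rewrite ≤ᵇ-true (≤-refl {suc (length r)}) | ≤ᵇ-false (n<1+n (length r)) | ≡ᵇ-true {suc (length r)} refl = refl
... | tri> _ _ d>1+r
  rewrite ≤ᵇ-false d>1+r | ≤ᵇ-false (<-trans (n<1+n (length r)) d>1+r) | ≡ᵇ-false (<⇒≢ d>1+r) = refl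

addCol≡insert-emptyColumn : ∀ {c} s t → Addable c t → colLength c t ≡ 0 → s <ᵀ t → addCol c s t ≡ insert s t
addCol≡insert-emptyColumn s []       new-row     _ _ = refl
addCol≡insert-emptyColumn s (r ∷ rs) (above c≤r _) col≡0 _ rewrite ≤ᵇ-true c≤r with col≡0
... | ()
addCol≡insert-emptyColumn s (r ∷ rs) (row-end _) _ s<t =
  addCol≡insert-beyondBottom _ s (r ∷ rs) (n<1+n (length r)) s<t

-- Masked words

MaskedWord : Set
MaskedWord = List (Maybe ℕ)

buildTᵐ : ℕ → MaskedWord → Tableau
buildTᵐ p []            = []
buildTᵐ p (nothing ∷ u) = buildTᵐ (suc p) u
buildTᵐ p (just c ∷ u)  = addCol c p (buildTᵐ (suc p) u)

occᵐ : ℕ → MaskedWord → ℕ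
occᵐ d []            = 0
occᵐ d (nothing ∷ u) = occᵐ d u
occᵐ d (just c ∷ u)  = if c ≡ᵇ d then suc (occᵐ d u) else occᵐ d u

IsReverseLatticeᵐ : MaskedWord → Set
IsReverseLatticeᵐ u = ∀ (k j : ℕ) → 1 ≤ j → occᵐ (suc j) (drop k u) ≤ occᵐ j (drop k u)

Positiveᵐ : MaskedWord → Set
Positiveᵐ = All (Maybe.All (1 ≤_))

ColumnsCount : Tableau → MaskedWord → Set
ColumnsCount t u = ∀ d → 1 ≤ d → colLength d t ≡ occᵐ d u

buildTᵐ-just : ∀ p w → buildTᵐ p (map just w) ≡ buildT p w
buildTᵐ-just p []      = refl
buildTᵐ-just p (c ∷ w) = cong (addCol c p) (buildTᵐ-just (suc p) w)

IsReverseLatticeᵐ-tail : ∀ {x u} → IsReverseLatticeᵐ (x ∷ u) → IsReverseLatticeᵐ u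
IsReverseLatticeᵐ-tail lattice k = lattice (suc k)

addable-next : ∀ {b} c t v → Partition≤ b t → ColumnsCount t v →
               IsReverseLatticeᵐ (just c ∷ v) → 1 ≤ c → Addable c t
addable-next (suc zero)     t v p _    _       _ = addable-1 t p
addable-next (suc (suc c)) t v p cols lattice _ =
  addable-colLength< c t p (subst₂ _<_ (sym (cols (2 + c) (s≤s z≤n))) (sym (cols (1 + c) (s≤s z≤n))) occ<)
  where
  occ< : occᵐ (2 + c) v < occᵐ (1 + c) v
  occ< with lattice 0 (1 + c) (s≤s z≤n)
  ... | bound rewrite ≡ᵇ-true {2 + c} refl | ≡ᵇ-false {2 + c} {1 + c} (>⇒≢ ≤-refl) = bound

buildTᵐ-shape : ∀ p u → IsReverseLatticeᵐ u → Positiveᵐ u →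
                (∃[ b ] Partition≤ b (buildTᵐ p u)) × ColumnsCount (buildTᵐ p u) u
buildTᵐ-shape p []            _       _           = (0 , tt) , λ _ _ → refl
buildTᵐ-shape p (nothing ∷ u) lattice (_ ∷ pos)   =
  buildTᵐ-shape (suc p) u (IsReverseLatticeᵐ-tail lattice) pos
buildTᵐ-shape p (just c ∷ u)  lattice (Maybe.just c≥1 ∷ pos)
  with buildTᵐ-shape (suc p) u (IsReverseLatticeᵐ-tail lattice) pos
... | (b , part) , cols =
  (b ⊔ c , addCol-Partition≤ p t addable (Partition≤-weaken t (m≤m⊔n b c) part) (m≤n⊔m b c)) ,
  λ d d≥1 → trans (colLength-addCol d p t addable d≥1) (cong (λ n → if c ≡ᵇ d then suc n else n) (cols d d≥1))
  where
  t = buildTᵐ (suc p) u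
  addable : Addable c t
  addable = addable-next c t u part cols lattice c≥1

buildTᵐ-addable : ∀ p c v → IsReverseLatticeᵐ (just c ∷ v) → Positiveᵐ (just c ∷ v) → Addable c (buildTᵐ p v)
buildTᵐ-addable p c v lattice (Maybe.just c≥1 ∷ pos)
  with buildTᵐ-shape p v (IsReverseLatticeᵐ-tail lattice) pos
... | (_ , part) , cols = addable-next c (buildTᵐ p v) v part cols lattice c≥1

buildTᵐ-entries≥ : ∀ p u → All (All (p ≤_)) (buildTᵐ p u)
buildTᵐ-entries≥ p []            = []
buildTᵐ-entries≥ p (nothing ∷ u) = All.map (All.map (≤-trans (n≤1+n p))) (buildTᵐ-entries≥ (suc p) u)
buildTᵐ-entries≥ p (just c ∷ u)  =
  addCol-All c p _ ≤-refl (All.map (All.map (≤-trans (n≤1+n p))) (buildTᵐ-entries≥ (suc p) u))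

-- u is u′ with the masked letter m at position d revealed, and no later letter m of u is revealed.
data Unmasks (m : ℕ) : ℕ → MaskedWord → MaskedWord → Set where
  here  : ∀ {v} → occᵐ m v ≡ 0 → Unmasks m 0 (just m ∷ v) (nothing ∷ v)
  there : ∀ {d x v v′} → Unmasks m d v v′ → Unmasks m (suc d) (x ∷ v) (x ∷ v′)

buildTᵐ-unmask : ∀ {m d u u′} p → Unmasks m d u u′ →
                 IsReverseLatticeᵐ u → IsReverseLatticeᵐ u′ → Positiveᵐ u → Positiveᵐ u′ →
                 buildTᵐ p u ≡ insert (p + d) (buildTᵐ p u′)
buildTᵐ-unmask {m} p (here {v} occ≡0) lattice _ pos@(Maybe.just m≥1 ∷ pos′) _ rewrite +-identityʳ p =
  addCol≡insert-emptyColumn p (buildTᵐ (suc p) v) (buildTᵐ-addable (suc p) m v lattice pos)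
    (trans (proj₂ (buildTᵐ-shape (suc p) v (IsReverseLatticeᵐ-tail lattice) pos′) m m≥1) occ≡0)
    (buildTᵐ-entries≥ (suc p) v)
buildTᵐ-unmask p (there {d} {nothing} unmask) lattice lattice′ (_ ∷ pos) (_ ∷ pos′) rewrite +-suc p d =
  buildTᵐ-unmask (suc p) unmask (IsReverseLatticeᵐ-tail lattice) (IsReverseLatticeᵐ-tail lattice′) pos pos′
buildTᵐ-unmask p (there {d} {just c} {v} {v′} unmask) lattice lattice′ (_ ∷ pos) pos′@(_ ∷ pos′ₜ)
  rewrite buildTᵐ-unmask (suc p) unmask (IsReverseLatticeᵐ-tail lattice) (IsReverseLatticeᵐ-tail lattice′) pos pos′ₜ
        | +-suc p d =
  addCol-insert-comm p (suc (p + d)) (buildTᵐ (suc p) v′) (buildTᵐ-addable (suc p) c v′ lattice′ pos′)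
    (buildTᵐ-entries≥ (suc p) v′) (s≤s (m≤m+n p d))

-- Standardization

indicator : Bool → ℕ
indicator true  = 1
indicator false = 0

countBy-∷ : ∀ (p : ℕ → Bool) y l → countBy p (y ∷ l) ≡ indicator (p y) + countBy p l
countBy-∷ p y l with p y
... | true  = refl
... | false = refl

countBy-+-mono-≤ : ∀ (p q r : ℕ → Bool) → (∀ y → indicator (p y) + indicator (q y) ≤ indicator (r y)) →
                   ∀ l → countBy p l + countBy q l ≤ countBy r l
countBy-+-mono-≤ p q r pointwise []      = z≤n
countBy-+-mono-≤ p q r pointwise (y ∷ l)
  rewrite countBy-∷ p y l | countBy-∷ q y l | countBy-∷ r y l =
  ≤-trans (≤-reflexive (interchange (indicator (p y)) (countBy p l) (indicator (q y)) (countBy q l)))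
          (+-mono-≤ (pointwise y) (countBy-+-mono-≤ p q r pointwise l))

countLess : ℕ → List ℕ → ℕ
countLess x = countBy (λ y → y <ᵇ x)

countEq : ℕ → List ℕ → ℕ
countEq x = countBy (λ y → y ≡ᵇ x)

countLess+countEq≤countLess : ∀ {x x′} w → x < x′ → countLess x w + countEq x w ≤ countLess x′ w
countLess+countEq≤countLess {x} {x′} w x<x′ = countBy-+-mono-≤ _ _ _ pointwise w
  where
  pointwise : ∀ y → indicator (y <ᵇ x) + indicator (y ≡ᵇ x) ≤ indicator (y <ᵇ x′)
  pointwise y with <-cmp y x
  ... | tri< y<x _ _ rewrite <ᵇ-true y<x | ≡ᵇ-false (<⇒≢ y<x) | <ᵇ-true (<-trans y<x x<x′) = ≤-refl
  ... | tri≈ _ refl _ rewrite <ᵇ-false (≤-refl {y}) | ≡ᵇ-true {y} refl | <ᵇ-true x<x′ = ≤-refl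
  ... | tri> _ _ y>x rewrite <ᵇ-false (<⇒≤ y>x) | ≡ᵇ-false (>⇒≢ y>x) = z≤n

countLess+countEq≤length : ∀ x w → countLess x w + countEq x w ≤ length w
countLess+countEq≤length x w =
  subst (countLess x w + countEq x w ≤_) (countBy-true w) (countBy-+-mono-≤ _ _ (λ _ → true) pointwise w)
  where
  countBy-true : ∀ l → countBy (λ _ → true) l ≡ length l
  countBy-true []      = refl
  countBy-true (_ ∷ l) = cong suc (countBy-true l)
  pointwise : ∀ y → indicator (y <ᵇ x) + indicator (y ≡ᵇ x) ≤ 1
  pointwise y with <-cmp y x
  ... | tri< y<x _ _ rewrite <ᵇ-true y<x | ≡ᵇ-false (<⇒≢ y<x) = ≤-refl
  ... | tri≈ _ refl _ rewrite <ᵇ-false (≤-refl {y}) | ≡ᵇ-true {y} refl = ≤-refl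
  ... | tri> _ _ y>x rewrite <ᵇ-false (<⇒≤ y>x) | ≡ᵇ-false (>⇒≢ y>x) = z≤n

stdValue : List ℕ → List ℕ → ℕ → ℕ
stdValue w pre x = suc (countLess x w + countEq x pre)

stdPairs : List ℕ → List ℕ → List ℕ → List (ℕ × ℕ)
stdPairs w pre []       = []
stdPairs w pre (x ∷ xs) = (x , stdValue w pre x) ∷ stdPairs w (x ∷ pre) xs

map-proj₁-stdPairs : ∀ w pre xs → map proj₁ (stdPairs w pre xs) ≡ xs
map-proj₁-stdPairs w pre []       = refl
map-proj₁-stdPairs w pre (x ∷ xs) = cong (x ∷_) (map-proj₁-stdPairs w (x ∷ pre) xs)

map-proj₂-stdPairs : ∀ w pre xs → map proj₂ (stdPairs w pre xs) ≡ stdGo w pre xs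
map-proj₂-stdPairs w pre []       = refl
map-proj₂-stdPairs w pre (x ∷ xs) = cong (_ ∷_) (map-proj₂-stdPairs w (x ∷ pre) xs)

length-stdPairs : ∀ w pre xs → length (stdPairs w pre xs) ≡ length xs
length-stdPairs w pre []       = refl
length-stdPairs w pre (x ∷ xs) = cong suc (length-stdPairs w (x ∷ pre) xs)

-- How a pair (letter , value) compares with a later one: smaller letters get smaller values, ties go to the earlier one.
StdOrdered : ℕ × ℕ → ℕ × ℕ → Set
StdOrdered (x , i) (x′ , i′) = (x ≤ x′ → i < i′) × (x′ < x → i′ < i)

record Splits (w pre xs : List ℕ) : Set where
  constructor splits
  field countEq-+ : ∀ d → countEq d pre + countEq d xs ≡ countEq d w
open Splits

Splits-shift : ∀ {w pre x xs} → Splits w pre (x ∷ xs) → Splits w (x ∷ pre) xs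
Splits-shift {x = x} (splits counts) = splits λ d → shift d (counts d)
  where
  shift : ∀ {m n k} d → m + (if x ≡ᵇ d then suc n else n) ≡ k → (if x ≡ᵇ d then suc m else m) + n ≡ k
  shift {m} {n} d e with x ≡ᵇ d
  ... | true  = trans (sym (+-suc m n)) e
  ... | false = e

countEq-self : ∀ x l → countEq x (x ∷ l) ≡ suc (countEq x l)
countEq-self x l rewrite ≡ᵇ-true {x} refl = refl

countEq-∷-≤ : ∀ x y l → countEq x l ≤ countEq x (y ∷ l)
countEq-∷-≤ x y l with y ≡ᵇ x
... | true  = n≤1+n _
... | false = ≤-refl

countEq-pre< : ∀ {w pre x xs} → Splits w pre (x ∷ xs) → countEq x pre < countEq x w
countEq-pre< {w} {pre} {x} {xs} split = begin-strict
  countEq x pre                     <⟨ m<m+n (countEq x pre) (s≤s z≤n) ⟩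
  countEq x pre + suc (countEq x xs) ≡⟨ cong (countEq x pre +_) (sym (countEq-self x xs)) ⟩
  countEq x pre + countEq x (x ∷ xs) ≡⟨ countEq-+ split x ⟩
  countEq x w                       ∎
  where open ≤-Reasoning

stdValue≤ : ∀ w pre x → countEq x pre < countEq x w → stdValue w pre x ≤ countLess x w + countEq x w
stdValue≤ w pre x = +-monoʳ-< (countLess x w)

stdValue-ordered : ∀ w x pre pre′ xs → Splits w pre′ xs → countEq x pre < countEq x pre′ → countEq x pre < countEq x w →
                   All (StdOrdered (x , stdValue w pre x)) (stdPairs w pre′ xs)
stdValue-ordered w x pre pre′ []        _      _        _ = []
stdValue-ordered w x pre pre′ (x′ ∷ xs) split pre<pre′ pre<w =
  (x≤x′⇒< , x′<x⇒<) ∷ stdValue-ordered w x pre (x′ ∷ pre′) xs (Splits-shift split)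
                        (≤-trans pre<pre′ (countEq-∷-≤ x x′ pre′)) pre<w
  where
  x≤x′⇒< : x ≤ x′ → stdValue w pre x < stdValue w pre′ x′
  x≤x′⇒< x≤x′ with <-cmp x x′
  ... | tri< x<x′ _ _ = s≤s (≤-trans (stdValue≤ w pre x pre<w)
                                (≤-trans (countLess+countEq≤countLess w x<x′) (m≤m+n _ _)))
  ... | tri≈ _ refl _ = s≤s (+-monoʳ-< (countLess x w) pre<pre′)
  ... | tri> _ _ x>x′ = ⊥-elim (<⇒≱ x>x′ x≤x′)
  x′<x⇒< : x′ < x → stdValue w pre′ x′ < stdValue w pre x
  x′<x⇒< x′<x = s≤s (≤-trans (stdValue≤ w pre′ x′ (countEq-pre< split))
                       (≤-trans (countLess+countEq≤countLess w x′<x) (m≤m+n _ _)))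

stdPairs-ordered : ∀ w pre xs → Splits w pre xs → AllPairs StdOrdered (stdPairs w pre xs)
stdPairs-ordered w pre []       _      = []
stdPairs-ordered w pre (x ∷ xs) split =
  stdValue-ordered w x pre (x ∷ pre) xs (Splits-shift split) (≤-reflexive (sym (countEq-self x pre)))
    (countEq-pre< split)
  ∷ stdPairs-ordered w (x ∷ pre) xs (Splits-shift split)

InRange : ℕ → ℕ → Set
InRange N y = 1 ≤ y × y ≤ N

stdPairs-bounded : ∀ w pre xs → Splits w pre xs → All (InRange (length w) ∘ proj₂) (stdPairs w pre xs)
stdPairs-bounded w pre []       _      = []
stdPairs-bounded w pre (x ∷ xs) split =
  (s≤s z≤n , ≤-trans (stdValue≤ w pre x (countEq-pre< split)) (countLess+countEq≤length x w))
  ∷ stdPairs-bounded w (x ∷ pre) xs (Splits-shift split)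

-- Pigeonhole: punch x maps 1 … N+1 without x injectively into 1 … N.
punch : ℕ → ℕ → ℕ
punch x y = if y <ᵇ x then y else pred y

punch-cases : ∀ x {y} → y ≢ x → (y < x × punch x y ≡ y) ⊎ (x < y × suc (punch x y) ≡ y)
punch-cases x {y} y≢x with <-cmp y x
... | tri< y<x _ _ rewrite <ᵇ-true y<x = inj₁ (y<x , refl)
... | tri≈ _ y≡x _ = ⊥-elim (y≢x y≡x)
... | tri> _ _ x<y@(s≤s _) rewrite <ᵇ-false (<⇒≤ x<y) = inj₂ (x<y , refl)

punch-injective : ∀ x {y z} → y ≢ x → z ≢ x → punch x y ≡ punch x z → y ≡ z
punch-injective x y≢x z≢x e with punch-cases x y≢x | punch-cases x z≢x
... | inj₁ (_ , py)   | inj₁ (_ , pz)   = trans (sym py) (trans e pz)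
... | inj₂ (_ , py)   | inj₂ (_ , pz)   = trans (sym py) (trans (cong suc e) pz)
... | inj₁ (y<x , py) | inj₂ (x<z , pz) =
  ⊥-elim (<⇒≱ y<x (subst (x ≤_) (trans (sym e) py) (≤-pred (subst (x <_) (sym pz) x<z))))
... | inj₂ (x<y , py) | inj₁ (z<x , pz) =
  ⊥-elim (<⇒≱ z<x (subst (x ≤_) (trans e pz) (≤-pred (subst (x <_) (sym py) x<y))))

punch-InRange : ∀ N x {y} → y ≢ x → InRange (suc N) x → InRange (suc N) y → InRange N (punch x y)
punch-InRange N x y≢x (1≤x , x≤1+N) (1≤y , y≤1+N) with punch-cases x y≢x
... | inj₁ (y<x , py) rewrite py = 1≤y , ≤-pred (≤-trans y<x x≤1+N)
... | inj₂ (x<y , py) =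
  ≤-trans 1≤x (≤-pred (subst (x <_) (sym py) x<y)) , ≤-pred (subst (_≤ suc N) (sym py) y≤1+N)

distinct-InRange⇒length≤ : ∀ N xs → AllPairs _≢_ xs → All (InRange N) xs → length xs ≤ N
distinct-InRange⇒length≤ N       []       _            _ = z≤n
distinct-InRange⇒length≤ zero    (x ∷ xs) _            ((1≤x , x≤0) ∷ _) = ⊥-elim (<⇒≱ 1≤x x≤0)
distinct-InRange⇒length≤ (suc N) (x ∷ xs) (x≢xs ∷ distinct) (x∈ ∷ xs∈) =
  s≤s (subst (_≤ N) (length-map (punch x) xs)
        (distinct-InRange⇒length≤ N (map (punch x) xs) (punched xs xs≢x distinct) (map⁺ (punchedInRange xs≢x xs∈))))
  where
  xs≢x : All (_≢ x) xs
  xs≢x = All.map (_∘ sym) x≢xs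
  punchedInRange : ∀ {ys} → All (_≢ x) ys → All (InRange (suc N)) ys → All (InRange N ∘ punch x) ys
  punchedInRange []           []           = []
  punchedInRange (y≢x ∷ ys≢x) (y∈ ∷ ys∈) = punch-InRange N x y≢x x∈ y∈ ∷ punchedInRange ys≢x ys∈
  punched : ∀ ys → All (_≢ x) ys → AllPairs _≢_ ys → AllPairs _≢_ (map (punch x) ys)
  punched []       []           []                  = []
  punched (y ∷ ys) (y≢x ∷ ys≢x) (y≢ys ∷ distinctys) =
    map⁺ (All.zipWith (λ (y≢z , z≢x) → y≢z ∘ punch-injective x y≢x z≢x) (y≢ys , ys≢x))
    ∷ punched ys ys≢x distinctys

StdOrdered⇒≢ : ∀ {a b} → StdOrdered a b → proj₂ a ≢ proj₂ b
StdOrdered⇒≢ {x , _} {x′ , _} (x≤x′⇒< , x′<x⇒<) with x ≤? x′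
... | yes x≤x′ = <⇒≢ (x≤x′⇒< x≤x′)
... | no  x≰x′ = >⇒≢ (x′<x⇒< (≰⇒> x≰x′))

StdOrdered-letter< : ∀ {zs a b} → AllPairs StdOrdered zs → a ∈ zs → b ∈ zs →
                     proj₁ a < proj₁ b → proj₂ a < proj₂ b
StdOrdered-letter< (_ ∷ _)       (here refl) (here refl) a<a = ⊥-elim (<-irrefl refl a<a)
StdOrdered-letter< (a≺ ∷ _)      (here refl) (there b∈) a<b = proj₁ (All.lookup a≺ b∈) (<⇒≤ a<b)
StdOrdered-letter< (b≺ ∷ _)      (there a∈) (here refl) a<b = proj₂ (All.lookup b≺ a∈) a<b
StdOrdered-letter< (_ ∷ ordered) (there a∈) (there b∈) a<b = StdOrdered-letter< ordered a∈ b∈ a<b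

values-cover : ∀ zs → AllPairs StdOrdered zs → All (InRange (length zs) ∘ proj₂) zs →
               ∀ {v} → InRange (length zs) v → Any ((_≡ v) ∘ proj₂) zs
values-cover zs ordered inRange {v} v∈ with any? ((_≟ v) ∘ proj₂) zs
... | yes hit = hit
... | no miss = ⊥-elim (<-irrefl refl (subst (λ n → suc n ≤ length zs) (length-map proj₂ zs) tooLong))
  where
  tooLong : length (v ∷ map proj₂ zs) ≤ length zs
  tooLong = distinct-InRange⇒length≤ (length zs) (v ∷ map proj₂ zs)
    (map⁺ (All.map (_∘ sym) (¬Any⇒All¬ zs miss)) ∷ AllPairs.map⁺ (AllPairs.map StdOrdered⇒≢ ordered))
    (v∈ ∷ map⁺ inRange)

-- Revealing letters by standardized value

reveal : ℕ → ℕ × ℕ → Maybe ℕ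
reveal k (x , i) = if i ≤ᵇ k then just x else nothing

reveal-suc : ∀ k {a} → proj₂ a ≢ suc k → reveal (suc k) a ≡ reveal k a
reveal-suc k {x , i} i≢1+k with i ≤? k
... | yes i≤k rewrite ≤ᵇ-true i≤k | ≤ᵇ-true (m≤n⇒m≤1+n i≤k) = refl
... | no  i≰k rewrite ≤ᵇ-false (≰⇒> i≰k) | ≤ᵇ-false (≤∧≢⇒< (≰⇒> i≰k) (i≢1+k ∘ sym)) = refl

reveal-all : ∀ k zs → All ((_≤ k) ∘ proj₂) zs → map (reveal k) zs ≡ map just (map proj₁ zs)
reveal-all k []             []           = refl
reveal-all k ((x , i) ∷ zs) (i≤k ∷ zs≤k) rewrite ≤ᵇ-true i≤k = cong (just x ∷_) (reveal-all k zs zs≤k)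

buildTᵐ-reveal-0 : ∀ p zs → All ((1 ≤_) ∘ proj₂) zs → buildTᵐ p (map (reveal 0) zs) ≡ []
buildTᵐ-reveal-0 p []             []           = refl
buildTᵐ-reveal-0 p ((x , i) ∷ zs) (1≤i ∷ zs≥1) rewrite ≤ᵇ-false 1≤i = buildTᵐ-reveal-0 (suc p) zs zs≥1

occᵐ-reveal≡0 : ∀ k d zs → All (λ z → proj₁ z ≡ d → k < proj₂ z) zs → occᵐ d (map (reveal k) zs) ≡ 0
occᵐ-reveal≡0 k d []             []          = refl
occᵐ-reveal≡0 k d ((x , i) ∷ zs) (hidden ∷ h) with i ≤? k
... | yes i≤k rewrite ≤ᵇ-true i≤k | ≡ᵇ-false (λ x≡d → <⇒≱ (hidden x≡d) i≤k) = occᵐ-reveal≡0 k d zs h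
... | no  i≰k rewrite ≤ᵇ-false (≰⇒> i≰k) = occᵐ-reveal≡0 k d zs h

occᵐ-reveal≤occ : ∀ k d zs → occᵐ d (map (reveal k) zs) ≤ occ d (map proj₁ zs)
occᵐ-reveal≤occ k d []             = z≤n
occᵐ-reveal≤occ k d ((x , i) ∷ zs) with i ≤ᵇ k
... | true with x ≡ᵇ d
...   | true  = s≤s (occᵐ-reveal≤occ k d zs)
...   | false = occᵐ-reveal≤occ k d zs
occᵐ-reveal≤occ k d ((x , i) ∷ zs) | false with x ≡ᵇ d
...   | true  = m≤n⇒m≤1+n (occᵐ-reveal≤occ k d zs)
...   | false = occᵐ-reveal≤occ k d zs

occᵐ-reveal≡occ : ∀ k d zs → All (λ z → proj₁ z ≡ d → proj₂ z ≤ k) zs →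
                  occᵐ d (map (reveal k) zs) ≡ occ d (map proj₁ zs)
occᵐ-reveal≡occ k d []             []           = refl
occᵐ-reveal≡occ k d ((x , i) ∷ zs) (shown ∷ h) with i ≤? k
... | yes i≤k rewrite ≤ᵇ-true i≤k with x ≡ᵇ d
...   | true  = cong suc (occᵐ-reveal≡occ k d zs h)
...   | false = occᵐ-reveal≡occ k d zs h
occᵐ-reveal≡occ k d ((x , i) ∷ zs) (shown ∷ h) | no i≰k
  rewrite ≤ᵇ-false (≰⇒> i≰k) | ≡ᵇ-false (i≰k ∘ shown) = occᵐ-reveal≡occ k d zs h

map-reveal-suc : ∀ k zs → All ((_≢ suc k) ∘ proj₂) zs → map (reveal (suc k)) zs ≡ map (reveal k) zs
map-reveal-suc k []       []           = refl
map-reveal-suc k (z ∷ zs) (i≢1+k ∷ h) = cong₂ _∷_ (reveal-suc k i≢1+k) (map-reveal-suc k zs h)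

reveal-Unmasks : ∀ k zs → AllPairs StdOrdered zs → Any ((_≡ suc k) ∘ proj₂) zs →
                 Σ ℕ λ m → Σ ℕ λ d →
                   Unmasks m d (map (reveal (suc k)) zs) (map (reveal k) zs) × pos (suc k) (map proj₂ zs) ≡ suc d
reveal-Unmasks k ((x , i) ∷ zs) (x≺ ∷ ordered) hit with i ≟ suc k
... | yes refl
  rewrite ≤ᵇ-true (≤-refl {suc k}) | ≤ᵇ-false (n<1+n k) | ≡ᵇ-true {suc k} refl
        | map-reveal-suc k zs (All.map (λ x≺z → StdOrdered⇒≢ x≺z ∘ sym) x≺) =
  x , 0 , here (occᵐ-reveal≡0 k x zs (All.map (λ x≺z x≡ → <-trans (n<1+n k) (proj₁ x≺z (≤-reflexive (sym x≡)))) x≺)) , refl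
... | no i≢1+k with hit
...   | here i≡1+k = ⊥-elim (i≢1+k i≡1+k)
...   | there hit′ with reveal-Unmasks k zs ordered hit′
...     | m , d , unmask , pos≡ rewrite reveal-suc k {x , i} i≢1+k | ≡ᵇ-false i≢1+k =
  m , suc d , there unmask , cong suc pos≡

hidden-letter⇒hidden-successor : ∀ {zs j k} → AllPairs StdOrdered zs → Any (λ z → proj₁ z ≡ j × k < proj₂ z) zs →
                                 All (λ z → proj₁ z ≡ suc j → k < proj₂ z) zs
hidden-letter⇒hidden-successor ordered hit with find hit
... | a , a∈ , (a≡j , k<a) = All.tabulate λ b∈ b≡1+j →
  <-trans k<a (StdOrdered-letter< ordered a∈ b∈ (subst₂ _<_ (sym a≡j) (sym b≡1+j) (n<1+n _)))

reveal-IsReverseLatticeᵐ : ∀ k zs → AllPairs StdOrdered zs → IsReverseLattice (map proj₁ zs) →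
                           IsReverseLatticeᵐ (map (reveal k) zs)
-- Either some letter j is still masked, and then so is every letter j+1, or every letter j is revealed.
reveal-IsReverseLatticeᵐ k zs ordered lattice t j j≥1 rewrite drop-map {f = reveal k} t zs
  with any? (λ z → (proj₁ z ≟ j) ×-dec (k <? proj₂ z)) zs
... | yes hit
  rewrite occᵐ-reveal≡0 k (suc j) (drop t zs) (drop⁺ t (hidden-letter⇒hidden-successor ordered hit)) = z≤n
... | no miss = begin
  occᵐ (suc j) (map (reveal k) (drop t zs)) ≤⟨ occᵐ-reveal≤occ k (suc j) (drop t zs) ⟩
  occ (suc j) (map proj₁ (drop t zs))       ≡⟨ cong (occ (suc j)) (sym (drop-map t zs)) ⟩
  occ (suc j) (drop t (map proj₁ zs))       ≤⟨ lattice t j j≥1 ⟩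
  occ j (drop t (map proj₁ zs))             ≡⟨ cong (occ j) (drop-map t zs) ⟩
  occ j (map proj₁ (drop t zs))             ≡⟨ sym (occᵐ-reveal≡occ k j (drop t zs) (drop⁺ t jShown)) ⟩
  occᵐ j (map (reveal k) (drop t zs))       ∎
  where
  open ≤-Reasoning
  jShown : All (λ z → proj₁ z ≡ j → proj₂ z ≤ k) zs
  jShown = All.map (λ ¬hidden z≡j → ≮⇒≥ (¬hidden ∘ (z≡j ,_))) (¬Any⇒All¬ zs miss)

reveal-Positiveᵐ : ∀ k zs → All ((1 ≤_) ∘ proj₁) zs → Positiveᵐ (map (reveal k) zs)
reveal-Positiveᵐ k []             []           = []
reveal-Positiveᵐ k ((x , i) ∷ zs) (1≤x ∷ pos) with i ≤ᵇ k
... | true  = Maybe.just 1≤x ∷ reveal-Positiveᵐ k zs pos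
... | false = Maybe.nothing ∷ reveal-Positiveᵐ k zs pos

inverseUpTo : ℕ → List ℕ → List ℕ
inverseUpTo k π = applyUpTo (λ i → pos (suc i) π) k

module _ (zs : List (ℕ × ℕ)) (ordered : AllPairs StdOrdered zs) (inRange : All (InRange (length zs) ∘ proj₂) zs)
         (lattice : IsReverseLattice (map proj₁ zs)) (positive : All ((1 ≤_) ∘ proj₁) zs) where

  P-inverseUpTo : ∀ k → k ≤ length zs → P (inverseUpTo k (map proj₂ zs)) ≡ buildTᵐ 1 (map (reveal k) zs)
  P-inverseUpTo zero    _   = sym (buildTᵐ-reveal-0 1 zs (All.map proj₁ inRange))
  P-inverseUpTo (suc k) k<n with reveal-Unmasks k zs ordered (values-cover zs ordered inRange (s≤s z≤n , k<n))
  ... | m , d , unmask , pos≡ = begin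
    P (inverseUpTo (suc k) π)                       ≡⟨ cong P (sym (applyUpTo-∷ʳ _ k)) ⟩
    P (inverseUpTo k π ∷ʳ pos (suc k) π)            ≡⟨ foldl-∷ʳ _ [] _ (inverseUpTo k π) ⟩
    insert (pos (suc k) π) (P (inverseUpTo k π))   ≡⟨ cong₂ insert pos≡ (P-inverseUpTo k (<⇒≤ k<n)) ⟩
    insert (suc d) (buildTᵐ 1 (map (reveal k) zs)) ≡⟨ sym (buildTᵐ-unmask 1 unmask
                                                         (reveal-IsReverseLatticeᵐ (suc k) zs ordered lattice)
                                                         (reveal-IsReverseLatticeᵐ k zs ordered lattice)
                                                         (reveal-Positiveᵐ (suc k) zs positive)
                                                         (reveal-Positiveᵐ k zs positive)) ⟩
    buildTᵐ 1 (map (reveal (suc k)) zs)             ∎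
    where
    open ≡-Reasoning
    π = map proj₂ zs

Positive⇒All : ∀ w → Positive w → All (1 ≤_) w
Positive⇒All []      _          = []
Positive⇒All (x ∷ w) (1≤x , pw) = 1≤x ∷ Positive⇒All w pw

corollary8p3 : (w : List ℕ) → Positive w → IsReverseLattice w →
                 T w ≡ P (inverse (std w))
corollary8p3 w positive lattice = begin
  T w                                          ≡⟨ sym (buildTᵐ-just 1 w) ⟩
  buildTᵐ 1 (map just w)                       ≡⟨ cong (buildTᵐ 1 ∘ map just) (sym letters) ⟩
  buildTᵐ 1 (map just (map proj₁ zs))          ≡⟨ cong (buildTᵐ 1) (sym (reveal-all (length zs) zs (All.map proj₂ inRange))) ⟩
  buildTᵐ 1 (map (reveal (length zs)) zs)      ≡⟨ sym (P-inverseUpTo zs ordered inRange lattice′ positive′ (length zs) ≤-refl) ⟩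
  P (inverseUpTo (length zs) (map proj₂ zs))   ≡⟨ cong (λ n → P (inverseUpTo n (map proj₂ zs))) (sym (length-map proj₂ zs)) ⟩
  P (inverse (map proj₂ zs))                   ≡⟨ cong (P ∘ inverse) (map-proj₂-stdPairs w [] w) ⟩
  P (inverse (std w))                          ∎
  where
  open ≡-Reasoning
  zs = stdPairs w [] w
  letters : map proj₁ zs ≡ w
  letters = map-proj₁-stdPairs w [] w
  split : Splits w [] w
  split = splits λ _ → refl
  ordered : AllPairs StdOrdered zs
  ordered = stdPairs-ordered w [] w split
  inRange : All (InRange (length zs) ∘ proj₂) zs
  inRange = subst (λ n → All (InRange n ∘ proj₂) zs) (sym (length-stdPairs w [] w)) (stdPairs-bounded w [] w split)
  lattice′ : IsReverseLattice (map proj₁ zs)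
  lattice′ = subst IsReverseLattice (sym letters) lattice
  positive′ : All ((1 ≤_) ∘ proj₁) zs
  positive′ = map⁻ (subst (All (1 ≤_)) (sym letters) (Positive⇒All w positive))
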